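{- Let $r, s \ge 1$ be integers. Let $a_1 < \dots < a_r$ and $b_1 < \dots < b_s$ be positive integers such that the greatest common divisor of all the numbers $a_1,\dots,a_r,b_1,\dots,b_s$ is $1$. Then for every integer $k$ the following hold. (i) There exist integers $x_1,\dots,x_r,y_1,\dots,y_s \ge 0$ with $\sum_{i=1}^r x_i a_i - \sum_{j=1}^s y_j b_j = k$. (ii) Moreover, such integers can be chosen so that, in addition, $\max_i x_i < b_s$ or $\max_j y_j < a_r$. -}

module Defs where

open import Data.Nat using (ℕ; zero; suc; _<_)
open import Data.Nat.GCD using (gcd)
open import Data.Fin using (Fin; fromℕ)
open import Data.Integer using (ℤ; +_; _-_)
open import Data.Vec.Functional using (foldr)

gcdFam : ∀ {n} → (Fin n → ℕ) → ℕ
gcdFam f = foldr gcd 0 f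

sumFam : ∀ {n} → (Fin n → ℕ) → ℕ
sumFam f = foldr Data.Nat._+_ 0 f

maxFam : ∀ {n} → (Fin n → ℕ) → ℕ
maxFam f = foldr Data.Nat._⊔_ 0 f

StrictlyIncreasing : ∀ {n} → (Fin n → ℕ) → Set
StrictlyIncreasing {n} f = ∀ (i j : Fin n) → Data.Fin._<_ i j → f i < f j

lastOf : ∀ {n} → (Fin (suc n) → ℕ) → ℕ
lastOf {n} f = f (fromℕ n)

combo : ∀ {r s} → (Fin r → ℕ) → (Fin s → ℕ) → (Fin r → ℕ) → (Fin s → ℕ) → ℤ
combo a b x y = (+ sumFam (λ i → x i Data.Nat.* a i)) - (+ sumFam (λ j → y j Data.Nat.* b j))

join : ∀ {r s} → (Fin r → ℕ) → (Fin s → ℕ) → Fin (r Data.Nat.+ s) → ℕ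
join {r} a b = Data.Vec.Functional._++_ a b

-- The integers Σ xᵢaᵢ − Σ yⱼbⱼ with xᵢ, yⱼ ≥ 0 form an additive submonoid of ℤ.
-- It contains the positive aᵢ and the negative −bⱼ, which makes it closed under
-- negation, hence a subgroup; being a subgroup containing every aᵢ and bⱼ, it
-- contains their gcd 1 (Bézout) and therefore all of ℤ.
-- For the bound: as long as some xᵢ ≥ b_s and some yⱼ ≥ a_r, lowering xᵢ by bⱼ and
-- yⱼ by aᵢ keeps the value and strictly decreases Σ xᵢaᵢ, so this process stops.

module Submission where

open import Data.Nat using (ℕ; zero; suc; _+_; _*_; _∸_; _≤_; _<_; _≤?_)
import Data.Nat.Properties as ℕ
open import Data.Nat.GCD using (gcd; gcd-GCD; module Bézout)
open import Data.Nat.Induction using (<-wellFounded)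
open import Data.Integer as ℤ using (ℤ; +_; -[1+_]; -_; _-_; _⊖_)
import Data.Integer.Properties as ℤₚ
open import Data.Integer.Tactic.RingSolver using (solve-∀)
open import Data.Fin using (Fin; fromℕ; splitAt; _≟_)
import Data.Fin.Properties as Fin
open import Data.Vec.Functional using (replicate; updateAt; zipWith; tail)
open import Data.Product using (∃₂; _×_; _,_)
open import Data.Sum using (_⊎_; inj₁; inj₂)
open import Function using (_∘_; const)
open import Induction.WellFounded using (Acc; acc)
open import Relation.Nullary using (yes; no)
open import Relation.Binary.PropositionalEquality
open import Algebra.Properties.Semiring.Sum ℕ.+-*-semiring
  using (sum; sum-cong-≗; ∑-distrib-+; sum-replicate-zero)
open import Algebra.Properties.CommutativeSemigroup ℕ.+-commutativeSemigroup
  using (x∙yz≈y∙xz)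

open import Defs

open ≡-Reasoning

infix 7 _·_

_·_ : ∀ {n} → (Fin n → ℕ) → (Fin n → ℕ) → ℕ
x · a = sum (λ t → x t * a t)

basis : ∀ {n} → Fin n → Fin n → ℕ
basis i = updateAt (replicate _ 0) i (const 1)

·-zeroˡ : ∀ {n} (a : Fin n → ℕ) → replicate n 0 · a ≡ 0
·-zeroˡ {n} a = sum-replicate-zero n

·-distribʳ-+ : ∀ {n} (x y a : Fin n → ℕ) → zipWith _+_ x y · a ≡ x · a + y · a
·-distribʳ-+ x y a =
  trans (sum-cong-≗ (λ t → ℕ.*-distribʳ-+ (a t) (x t) (y t)))
        (∑-distrib-+ (λ t → x t * a t) (λ t → y t * a t))

basis-· : ∀ {n} (i : Fin n) (a : Fin n → ℕ) → basis i · a ≡ a i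
basis-· {suc n} Fin.zero a = begin
  1 * a Fin.zero + sum (replicate n 0) ≡⟨ cong₂ _+_ (ℕ.*-identityˡ _) (sum-replicate-zero n) ⟩
  a Fin.zero + 0                       ≡⟨ ℕ.+-identityʳ _ ⟩
  a Fin.zero                           ∎
basis-· (Fin.suc i) a = basis-· i (tail a)

·-updateAt-∸ : ∀ {n} (x a : Fin n → ℕ) i {c} → c ≤ x i →
               x · a ≡ c * a i + updateAt x i (_∸ c) · a
·-updateAt-∸ x a Fin.zero {c} c≤x₀ = begin
  x₀ * a₀ + rest                  ≡⟨ cong (λ u → u * a₀ + rest) (ℕ.m+[n∸m]≡n c≤x₀) ⟨
  (c + (x₀ ∸ c)) * a₀ + rest      ≡⟨ cong (_+ rest) (ℕ.*-distribʳ-+ a₀ c (x₀ ∸ c)) ⟩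
  c * a₀ + (x₀ ∸ c) * a₀ + rest   ≡⟨ ℕ.+-assoc (c * a₀) _ rest ⟩
  c * a₀ + ((x₀ ∸ c) * a₀ + rest) ∎
  where
  x₀ a₀ rest : ℕ
  x₀ = x Fin.zero
  a₀ = a Fin.zero
  rest = tail x · tail a
·-updateAt-∸ x a (Fin.suc i) {c} c≤xᵢ = begin
  x₀a₀ + tail x · tail a             ≡⟨ cong (_+_ x₀a₀) (·-updateAt-∸ (tail x) (tail a) i c≤xᵢ) ⟩
  x₀a₀ + (c * a (Fin.suc i) + rest′) ≡⟨ x∙yz≈y∙xz x₀a₀ (c * a (Fin.suc i)) rest′ ⟩
  c * a (Fin.suc i) + (x₀a₀ + rest′) ∎
  where
  x₀a₀ rest′ : ℕ
  x₀a₀ = x Fin.zero * a Fin.zero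
  rest′ = updateAt (tail x) i (_∸ c) · tail a

m+n≡o⇒m≡o-n : ∀ {m n o} → m + n ≡ o → + m ≡ + o - + n
m+n≡o⇒m≡o-n {m} {n} {o} m+n≡o = begin
  + m             ≡⟨ cong +_ (ℕ.m+n∸n≡m m n) ⟨
  + (m + n ∸ n)   ≡⟨ ℤₚ.⊖-≥ (ℕ.m≤n+m n m) ⟨
  (m + n) ⊖ n     ≡⟨ cong (_⊖ n) m+n≡o ⟩
  o ⊖ n           ≡⟨ ℤₚ.m-n≡m⊖n o n ⟨
  + o - + n       ∎

gcd-linearCombination : ∀ m n → ∃₂ λ (u v : ℤ) → + gcd m n ≡ u ℤ.* + m ℤ.+ v ℤ.* + n
gcd-linearCombination m n with Bézout.identity (gcd-GCD m n)
... | Bézout.+- x y eq = + x , (- + y) , (begin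
  + gcd m n                       ≡⟨ m+n≡o⇒m≡o-n eq ⟩
  + (x * m) - + (y * n)           ≡⟨ cong₂ _-_ (ℤₚ.pos-* x m) (ℤₚ.pos-* y n) ⟩
  + x ℤ.* + m - + y ℤ.* + n       ≡⟨ cong (λ t → + x ℤ.* + m ℤ.+ t) (ℤₚ.neg-distribˡ-* (+ y) (+ n)) ⟩
  + x ℤ.* + m ℤ.+ - + y ℤ.* + n   ∎)
... | Bézout.-+ x y eq = (- + x) , + y , (begin
  + gcd m n                       ≡⟨ m+n≡o⇒m≡o-n eq ⟩
  + (y * n) - + (x * m)           ≡⟨ cong₂ _-_ (ℤₚ.pos-* y n) (ℤₚ.pos-* x m) ⟩
  + y ℤ.* + n - + x ℤ.* + m       ≡⟨ swap (+ y) (+ n) (+ x) (+ m) ⟩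
  - + x ℤ.* + m ℤ.+ + y ℤ.* + n   ∎)
  where
  swap : ∀ Y N X M → Y ℤ.* N - X ℤ.* M ≡ - X ℤ.* M ℤ.+ Y ℤ.* N
  swap = solve-∀

module AdditivelyClosed {ℓ} (P : ℤ → Set ℓ) (0∈P : P (+ 0))
                       (+-closed : ∀ {k l} → P k → P l → P (k ℤ.+ l)) where

  *ℕ-closed : ∀ n {k} → P k → P (+ n ℤ.* k)
  *ℕ-closed zero    {k} _  = subst P (sym (ℤₚ.*-zeroˡ k)) 0∈P
  *ℕ-closed (suc n) {k} Pk = subst P (sym (ℤₚ.suc-* (+ n) k)) (+-closed Pk (*ℕ-closed n Pk))

  -- For m = p + 1, n = q + 1 and K ≥ 0:  -K = q·K + K·(-n)  and  K = K·m + p·(-K).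
  neg-closed : ∀ {m n} → 0 < m → 0 < n → P (+ m) → P (- + n) → ∀ {k} → P k → P (- k)
  neg-closed {suc p} {suc q} _ _ _ Pn {+ k} Pk =
    subst P (cancel (+ q) (+ k)) (+-closed (*ℕ-closed q Pk) (*ℕ-closed k Pn))
    where
    cancel : ∀ Q K → Q ℤ.* K ℤ.+ K ℤ.* - (+ 1 ℤ.+ Q) ≡ - K
    cancel = solve-∀
  neg-closed {suc p} {suc q} _ _ Pm _ { -[1+ k ]} Pk =
    subst P (cancel (+ p) (+ suc k)) (+-closed (*ℕ-closed (suc k) Pm) (*ℕ-closed p Pk))
    where
    cancel : ∀ Q K → K ℤ.* (+ 1 ℤ.+ Q) ℤ.+ Q ℤ.* - K ≡ K
    cancel = solve-∀

  module _ {m n} (0<m : 0 < m) (0<n : 0 < n) (Pm : P (+ m)) (Pn : P (- + n)) where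

    *-closed : ∀ z {k} → P k → P (z ℤ.* k)
    *-closed (+ z)      Pk = *ℕ-closed z Pk
    *-closed -[1+ z ] {k} Pk =
      subst P (ℤₚ.neg-distribˡ-* (+ suc z) k) (neg-closed 0<m 0<n Pm Pn (*ℕ-closed (suc z) Pk))

    gcd-closed : ∀ {i j} → P (+ i) → P (+ j) → P (+ gcd i j)
    gcd-closed {i} {j} Pi Pj with u , v , eq ← gcd-linearCombination i j =
      subst P (sym eq) (+-closed (*-closed u Pi) (*-closed v Pj))

    gcdFam-closed : ∀ {r} (f : Fin r → ℕ) → (∀ t → P (+ f t)) → P (+ gcdFam f)
    gcdFam-closed {zero}  f Pf = 0∈P
    gcdFam-closed {suc r} f Pf = gcd-closed (Pf Fin.zero) (gcdFam-closed (tail f) (Pf ∘ Fin.suc))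

    universal : P (+ 1) → ∀ k → P k
    universal P1 k = subst P (ℤₚ.*-identityʳ k) (*-closed k P1)

module _ {r s} (a : Fin r → ℕ) (b : Fin s → ℕ) where

  Representable : ℤ → Set
  Representable k = ∃₂ λ x y → combo a b x y ≡ k

  combo-+ : ∀ x x′ y y′ →
            combo a b (zipWith _+_ x x′) (zipWith _+_ y y′) ≡ combo a b x y ℤ.+ combo a b x′ y′
  combo-+ x x′ y y′ = begin
    + (zipWith _+_ x x′ · a) - + (zipWith _+_ y y′ · b)
      ≡⟨ cong₂ (λ u v → + u - + v) (·-distribʳ-+ x x′ a) (·-distribʳ-+ y y′ b) ⟩
    + (x · a + x′ · a) - + (y · b + y′ · b)
      ≡⟨ cong₂ _-_ (ℤₚ.pos-+ (x · a) (x′ · a)) (ℤₚ.pos-+ (y · b) (y′ · b)) ⟩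
    (+ (x · a) ℤ.+ + (x′ · a)) - (+ (y · b) ℤ.+ + (y′ · b))
      ≡⟨ regroup (+ (x · a)) (+ (x′ · a)) (+ (y · b)) (+ (y′ · b)) ⟩
    combo a b x y ℤ.+ combo a b x′ y′ ∎
    where
    regroup : ∀ X X′ Y Y′ → (X ℤ.+ X′) - (Y ℤ.+ Y′) ≡ (X - Y) ℤ.+ (X′ - Y′)
    regroup = solve-∀

  representable-0 : Representable (+ 0)
  representable-0 = replicate r 0 , replicate s 0 ,
    cong₂ (λ u v → + u - + v) (·-zeroˡ a) (·-zeroˡ b)

  representable-+ : ∀ {k l} → Representable k → Representable l → Representable (k ℤ.+ l)
  representable-+ (x , y , refl) (x′ , y′ , refl) =
    zipWith _+_ x x′ , zipWith _+_ y y′ , combo-+ x x′ y y′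

  representable-a : ∀ i → Representable (+ a i)
  representable-a i = basis i , replicate s 0 , (begin
    + (basis i · a) - + (replicate s 0 · b) ≡⟨ cong₂ (λ u v → + u - + v) (basis-· i a) (·-zeroˡ b) ⟩
    + a i ℤ.+ + 0                          ≡⟨ ℤₚ.+-identityʳ (+ a i) ⟩
    + a i                                  ∎)

  representable-−b : ∀ j → Representable (- + b j)
  representable-−b j = replicate r 0 , basis j , (begin
    + (replicate r 0 · a) - + (basis j · b) ≡⟨ cong₂ (λ u v → + u - + v) (·-zeroˡ a) (basis-· j b) ⟩
    + 0 ℤ.+ - + b j                        ≡⟨ ℤₚ.+-identityˡ (- + b j) ⟩
    - + b j                                ∎)

  open AdditivelyClosed Representable representable-0 representable-+

  all-representable : ∀ {i j} → 0 < a i → 0 < b j →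
                      gcdFam (join a b) ≡ 1 → ∀ k → Representable k
  all-representable {i} {j} 0<aᵢ 0<bⱼ gcd≡1 = universal 0<aᵢ 0<bⱼ aᵢ∈ −bⱼ∈
    (subst (Representable ∘ +_) gcd≡1
      (gcdFam-closed 0<aᵢ 0<bⱼ aᵢ∈ −bⱼ∈ (join a b) representable-join))
    where
    aᵢ∈ : Representable (+ a i)
    aᵢ∈ = representable-a i
    −bⱼ∈ : Representable (- + b j)
    −bⱼ∈ = representable-−b j
    representable-join : ∀ t → Representable (+ join a b t)
    representable-join t with splitAt r t
    ... | inj₁ i′ = representable-a i′
    ... | inj₂ j′ = subst Representable (ℤₚ.neg-involutive (+ b j′))
                      (neg-closed 0<aᵢ 0<bⱼ aᵢ∈ −bⱼ∈ (representable-−b j′))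

combo-exchange : ∀ {r s} (a : Fin r → ℕ) (b : Fin s → ℕ) x y {i j} →
                 b j ≤ x i → a i ≤ y j →
                 combo a b (updateAt x i (_∸ b j)) (updateAt y j (_∸ a i)) ≡ combo a b x y
combo-exchange a b x y {i} {j} bⱼ≤xᵢ aᵢ≤yⱼ = begin
  + (x′ · a) - + (y′ · b)
    ≡⟨ ℤₚ.m-n≡m⊖n (x′ · a) (y′ · b) ⟩
  x′ · a ⊖ y′ · b
    ≡⟨ ℤₚ.+-cancelˡ-⊖ (b j * a i) (x′ · a) (y′ · b) ⟨
  (b j * a i + x′ · a) ⊖ (b j * a i + y′ · b)
    ≡⟨ cong₂ _⊖_ (sym (·-updateAt-∸ x a i bⱼ≤xᵢ)) y·b ⟩
  x · a ⊖ y · b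
    ≡⟨ ℤₚ.m-n≡m⊖n (x · a) (y · b) ⟨
  + (x · a) - + (y · b)
    ∎
  where
  x′ : Fin _ → ℕ
  x′ = updateAt x i (_∸ b j)
  y′ : Fin _ → ℕ
  y′ = updateAt y j (_∸ a i)
  y·b : b j * a i + y′ · b ≡ y · b
  y·b = trans (cong (_+ y′ · b) (ℕ.*-comm (b j) (a i))) (sym (·-updateAt-∸ y b j aᵢ≤yⱼ))

maxFam-< : ∀ {n m} (x : Fin n → ℕ) → 0 < m → (∀ i → x i < m) → maxFam x < m
maxFam-< {zero}  x 0<m _   = 0<m
maxFam-< {suc n} x 0<m x<m = ℕ.⊔-pres-<m (x<m Fin.zero) (maxFam-< (tail x) 0<m (x<m ∘ Fin.suc))

StrictlyIncreasing⇒≤lastOf : ∀ {n} {f : Fin (suc n) → ℕ} →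
                             StrictlyIncreasing f → ∀ i → f i ≤ lastOf f
StrictlyIncreasing⇒≤lastOf {n} f↑ i with i ≟ fromℕ n
... | yes refl = ℕ.≤-refl
... | no  i≢n  = ℕ.<⇒≤ (f↑ i (fromℕ n) (Fin.≤∧≢⇒< (Fin.≤fromℕ i) i≢n))

module _ {r s} (a : Fin r → ℕ) (b : Fin s → ℕ) {A B : ℕ}
         (0<a : ∀ i → 0 < a i) (0<b : ∀ j → 0 < b j) (0<A : 0 < A) (0<B : 0 < B)
         (a≤A : ∀ i → a i ≤ A) (b≤B : ∀ j → b j ≤ B) where

  bounded-representation : ∀ {k} → Representable a b k →
    ∃₂ λ x y → combo a b x y ≡ k × (maxFam x < B ⊎ maxFam y < A)
  bounded-representation {k} (x , y , eq) = go x y eq (<-wellFounded (x · a))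
    where
    go : ∀ x y → combo a b x y ≡ k → Acc _<_ (x · a) →
         ∃₂ λ x y → combo a b x y ≡ k × (maxFam x < B ⊎ maxFam y < A)
    go x y eq (acc smaller) with Fin.any? (λ i → B ≤? x i) | Fin.any? (λ j → A ≤? y j)
    ... | no ∄i | _ = x , y , eq , inj₁ (maxFam-< x 0<B (λ i → ℕ.≰⇒> (∄i ∘ (i ,_))))
    ... | yes _ | no ∄j = x , y , eq , inj₂ (maxFam-< y 0<A (λ j → ℕ.≰⇒> (∄j ∘ (j ,_))))
    ... | yes (i , B≤xᵢ) | yes (j , A≤yⱼ) =
      go x′ (updateAt y j (_∸ a i))
         (trans (combo-exchange a b x y bⱼ≤xᵢ aᵢ≤yⱼ) eq) (smaller decreasing)
      where
      bⱼ≤xᵢ : b j ≤ x i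
      bⱼ≤xᵢ = ℕ.≤-trans (b≤B j) B≤xᵢ
      aᵢ≤yⱼ : a i ≤ y j
      aᵢ≤yⱼ = ℕ.≤-trans (a≤A i) A≤yⱼ
      x′ : Fin r → ℕ
      x′ = updateAt x i (_∸ b j)
      decreasing : x′ · a < x · a
      decreasing = subst (x′ · a <_) (sym (·-updateAt-∸ x a i bⱼ≤xᵢ))
        (ℕ.m<n+m (x′ · a) (ℕ.*-mono-< (0<b j) (0<a i)))

lemma2 : (r s : ℕ) (a : Fin (suc r) → ℕ) (b : Fin (suc s) → ℕ)
         → StrictlyIncreasing a → StrictlyIncreasing b
         → (∀ i → 0 < a i) → (∀ j → 0 < b j)
         → gcdFam (join a b) ≡ 1
         → (k : ℤ)
         → (∃₂ λ (x : Fin (suc r) → ℕ) (y : Fin (suc s) → ℕ) → combo a b x y ≡ k)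
           × (∃₂ λ (x : Fin (suc r) → ℕ) (y : Fin (suc s) → ℕ)
                → combo a b x y ≡ k
                  × (maxFam x < lastOf b ⊎ maxFam y < lastOf a))
lemma2 r s a b a↑ b↑ 0<a 0<b gcd≡1 k = representation ,
  bounded-representation a b 0<a 0<b (0<a _) (0<b _)
    (StrictlyIncreasing⇒≤lastOf a↑) (StrictlyIncreasing⇒≤lastOf b↑) representation
  where
  representation : Representable a b k
  representation = all-representable a b (0<a Fin.zero) (0<b Fin.zero) gcd≡1 k
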